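{- For $r,s,t\in\mathbb{Z}$ let \[\phi_{(r,s,t)}(x)=\frac{rs\,x^3+s\,x+t}{x^2+1},\] and let $\beta_{(r,s,t)}=r^{n_1}s^{n_2}t^{n_3}$ where $n_1,n_2,n_3$ are integers with $\min\{n_1,n_2,n_3\}\geq6$. Then \[\limsup_{B\to\infty}\frac{\sum_{|r|,|s|,|t|\leq B}\#\Big(\mathcal{O}_{\phi_{(r,s,t)}}\big(\beta_{(r,s,t)}\big)\cap\mathbb{Z}\Big)}{(2B+1)^3}<\infty.\]
   Context: The sum is over integers $r,s,t$. $\mathcal{O}_\phi(b)=\{b,\phi(b),\phi^2(b),\dots\}$ is the forward orbit, and $\mathcal{O}_\phi(b)\cap\mathbb{Z}$ is the set of its points that are integers. -}

module Defs where

open import Data.Nat as ℕ using (ℕ; zero; suc)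
open import Data.Integer as ℤ using (ℤ; +_)
open import Data.Rational as ℚ using (ℚ; 0ℚ; 1ℚ; _+_; _*_; _÷_; NonZero; Positive; NonNegative)
open import Data.Rational.Properties as ℚP
open import Data.Sum using (inj₁; inj₂)
open import Data.Product using (∃)
open import Data.List using (List; []; _∷_; map; concatMap; upTo; length)
open import Data.Nat.ListAction using (sum)
open import Relation.Binary.PropositionalEquality using (_≡_)

sq-nonNeg : ∀ (x : ℚ) → NonNegative (x * x)
sq-nonNeg x with ℚP.≤-total 0ℚ x
... | inj₁ 0≤x = let instance _ = ℚ.nonNegative 0≤x in ℚP.nonNeg*nonNeg⇒nonNeg x x
... | inj₂ x≤0 = let instance _ = ℚ.nonPositive x≤0 in ℚP.nonPos*nonPos⇒nonPos x x

sq+1-nonZero : ∀ (x : ℚ) → NonZero (x * x + 1ℚ)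
sq+1-nonZero x =
  let instance _ = sq-nonNeg x in
  ℚP.pos⇒nonZero (x * x + 1ℚ) {{ℚP.nonNeg+pos⇒pos (x * x) 1ℚ}}

ι : ℤ → ℚ
ι z = z ℚ./ 1

φ : ℤ → ℤ → ℤ → ℚ → ℚ
φ r s t x =
  _÷_ (ι (r ℤ.* s) * (x * x * x) + ι s * x + ι t) (x * x + 1ℚ) {{sq+1-nonZero x}}

iter : (ℚ → ℚ) → ℕ → ℚ → ℚ
iter f zero    x = x
iter f (suc n) x = f (iter f n x)

InOrbit : (ℚ → ℚ) → ℚ → ℚ → Set
InOrbit f b y = ∃ λ n → iter f n b ≡ y

-- β_(r,s,t) = r^n₁ s^n₂ t^n₃ (exponents are naturals, since they are ≥ 6)
β : ℕ → ℕ → ℕ → ℤ → ℤ → ℤ → ℤ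
β n₁ n₂ n₃ r s t = (r ℤ.^ n₁) ℤ.* (s ℤ.^ n₂) ℤ.* (t ℤ.^ n₃)

range : ℕ → List ℤ
range B = map (λ i → (+ i) ℤ.- (+ B)) (upTo (suc (2 ℕ.* B)))

boxSum : ℕ → (ℤ → ℤ → ℤ → ℕ) → ℕ
boxSum B f = sum (concatMap (λ r → concatMap (λ s → map (λ t → f r s t) (range B)) (range B)) (range B))

module Submission where

-- If r, s, t ≠ 0, then φ(β) is not an integer: rs ∣ β and β is huge compared with r, s, t, or
-- else r, s, t, β are units and a parity argument applies. So the denominator of φ(β) has a prime
-- factor p ∤ rs. For x = a/d with p ∣ d, the numerator rs a³ + s a d² + t d³ of φ(x) is ≢ 0 (mod p)
-- while p divides the denominator d (a² + d²), so p divides every later denominator and β is the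
-- only integer in its orbit. If t = 0 the orbit of β = 0 is {0}, and if rs = 0 an integer value of
-- φ has absolute value at most |s| + |t| ≤ 2B. Hence every triple of the box contributes at most one
-- point, except those on the planes r = 0 and s = 0, which contribute O(B) each.

open import Defs
open import Data.Nat as ℕ using (ℕ; zero; suc; z≤n; s≤s)
import Data.Nat.Properties as ℕP
import Data.Nat.Solver as ℕSolver
import Data.Nat.Coprimality as NC
import Data.Nat.Divisibility as ℕD
open import Data.Nat.Primality using (Prime; euclidsLemma; ¬prime[1])
open import Data.Nat.Primality.Factorisation using (factorise)
open import Data.Nat.ListAction using (sum; product)
open import Data.Nat.ListAction.Properties using (sum-++)
open import Data.Integer as ℤ using (ℤ; +_; +[1+_]; -[1+_]; _⊖_)
import Data.Integer.Properties as ℤP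
import Data.Integer.Coprimality as ℤC
open import Data.Integer.Divisibility.Signed
  using (_∣_; divides; ∣-refl; ∣-trans; ∣⇒∣ᵤ; ∣ᵤ⇒∣; ∣m⇒∣m*n; ∣n⇒∣m*n; ∣m+n∣n⇒∣m; ∣m+n∣m⇒∣n; ∣m∣n⇒∣m+n; ∣m∣n⇒∣m-n)
open import Data.Integer.Solver using (module +-*-Solver)
open import Data.Rational as ℚ using (ℚ; mkℚ; 1ℚ; toℚᵘ)
import Data.Rational.Properties as ℚP
open import Data.Rational.Unnormalised as ℚᵘ using (mkℚᵘ; *≡*; _≃_)
import Data.Rational.Unnormalised.Properties as ℚᵘP
open import Data.List using (List; []; _∷_; length; map; filter; concatMap; upTo)
import Data.List.Properties as List
open import Data.List.Membership.Propositional using (_∈_)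
open import Data.List.Membership.Propositional.Properties using (∈-filter⁺; ∈-map⁺; ∈-map⁻; ∈-upTo⁺; ∈-upTo⁻)
open import Data.List.Relation.Unary.Any as Any using (here; there)
open import Data.List.Relation.Unary.All as All using (_∷_)
open import Data.List.Relation.Unary.AllPairs using (_∷_)
open import Data.List.Relation.Unary.Unique.Propositional using (Unique)
import Data.List.Relation.Unary.Unique.Propositional.Properties as Unique
open import Data.Product using (∃; ∃-syntax; _×_; _,_; proj₁; proj₂)
open import Data.Sum as Sum using (_⊎_; inj₁; inj₂)
open import Function using (id; _∘_)
open import Function.Bundles using (_⇔_; mk⇔; Equivalence)
open import Relation.Binary.Definitions using (DecidableEquality)
open import Relation.Binary.PropositionalEquality
open import Relation.Nullary using (¬_; ¬?; yes; no; contradiction)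
open import Relation.Nullary.Decidable using (from-no)

open +-*-Solver
module ℕS = ℕSolver.+-*-Solver

-- For x = a/d, φ r s t x = φ-num r s t a d / φ-den a d before cancellation.
φ-num : ℤ → ℤ → ℤ → ℤ → ℤ → ℤ
φ-num r s t a d = r ℤ.* s ℤ.* (a ℤ.* a ℤ.* a) ℤ.+ s ℤ.* a ℤ.* (d ℤ.* d) ℤ.+ t ℤ.* (d ℤ.* d ℤ.* d)

φ-den : ℤ → ℤ → ℤ
φ-den a d = d ℤ.* (a ℤ.* a ℤ.+ d ℤ.* d)

ι-num : ∀ z → ℚ.↥ (ι z) ≡ z
ι-num (+ n)    = cong ℚ.↥_ (ℚP.normalize-coprime (NC.sym (NC.1-coprimeTo n)))
ι-num -[1+ n ] = cong (λ q → ℚ.↥ (ℚ.- q)) (ℚP.normalize-coprime (NC.sym (NC.1-coprimeTo (suc n))))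

ι-den : ∀ z → ℚ.↧ (ι z) ≡ + 1
ι-den (+ n)    = cong ℚ.↧_ (ℚP.normalize-coprime (NC.sym (NC.1-coprimeTo n)))
ι-den -[1+ n ] = cong (λ q → ℚ.↧ (ℚ.- q)) (ℚP.normalize-coprime (NC.sym (NC.1-coprimeTo (suc n))))

ι-injective : ∀ y z → ι y ≡ ι z → y ≡ z
ι-injective y z ιy≡ιz = trans (sym (ι-num y)) (trans (cong ℚ.↥_ ιy≡ιz) (ι-num z))

ι-toℚᵘ : ∀ z → toℚᵘ (ι z) ≃ mkℚᵘ z 0
ι-toℚᵘ z = ℚP.toℚᵘ-fromℚᵘ (mkℚᵘ z 0)

module _ where
  open import Data.Rational using (_+_; _*_)

  φ-cleared : ∀ r s t x → φ r s t x * (x * x + 1ℚ) ≡ ι (r ℤ.* s) * (x * x * x) + ι s * x + ι t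
  φ-cleared r s t x = begin
    (E * 1/w) * w   ≡⟨ ℚP.*-assoc E 1/w w ⟩
    E * (1/w * w)   ≡⟨ cong (E *_) (ℚP.*-inverseˡ w) ⟩
    E * 1ℚ          ≡⟨ ℚP.*-identityʳ E ⟩
    E               ∎
    where
    open ≡-Reasoning
    E = ι (r ℤ.* s) * (x * x * x) + ι s * x + ι t
    w = x * x + 1ℚ
    instance
      w≢0 : ℚ.NonZero w
      w≢0 = sq+1-nonZero x
    1/w = ℚ.1/ w

  toℚᵘ-φ-cleared : ∀ r s t x → let X = toℚᵘ x in
    toℚᵘ (φ r s t x) ℚᵘ.* (X ℚᵘ.* X ℚᵘ.+ ℚᵘ.1ℚᵘ)
      ≃ mkℚᵘ (r ℤ.* s) 0 ℚᵘ.* (X ℚᵘ.* X ℚᵘ.* X) ℚᵘ.+ mkℚᵘ s 0 ℚᵘ.* X ℚᵘ.+ mkℚᵘ t 0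
  toℚᵘ-φ-cleared r s t x = begin
    toℚᵘ y ℚᵘ.* (X ℚᵘ.* X ℚᵘ.+ ℚᵘ.1ℚᵘ)
      ≈⟨ ℚᵘP.*-congˡ {toℚᵘ y} (ℚᵘP.+-congˡ ℚᵘ.1ℚᵘ (ℚᵘP.≃-sym (ℚP.toℚᵘ-homo-* x x))) ⟩
    toℚᵘ y ℚᵘ.* (toℚᵘ (x * x) ℚᵘ.+ toℚᵘ 1ℚ)
      ≈⟨ ℚᵘP.*-congˡ {toℚᵘ y} (ℚᵘP.≃-sym (ℚP.toℚᵘ-homo-+ (x * x) 1ℚ)) ⟩
    toℚᵘ y ℚᵘ.* toℚᵘ (x * x + 1ℚ)
      ≈⟨ ℚᵘP.≃-sym (ℚP.toℚᵘ-homo-* y (x * x + 1ℚ)) ⟩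
    toℚᵘ (y * (x * x + 1ℚ))
      ≈⟨ ℚP.toℚᵘ-cong (φ-cleared r s t x) ⟩
    toℚᵘ (ι (r ℤ.* s) * (x * x * x) + ι s * x + ι t)
      ≈⟨ ℚP.toℚᵘ-homo-+ (ι (r ℤ.* s) * (x * x * x) + ι s * x) (ι t) ⟩
    toℚᵘ (ι (r ℤ.* s) * (x * x * x) + ι s * x) ℚᵘ.+ toℚᵘ (ι t)
      ≈⟨ ℚᵘP.+-cong (ℚP.toℚᵘ-homo-+ (ι (r ℤ.* s) * (x * x * x)) (ι s * x)) (ι-toℚᵘ t) ⟩
    toℚᵘ (ι (r ℤ.* s) * (x * x * x)) ℚᵘ.+ toℚᵘ (ι s * x) ℚᵘ.+ mkℚᵘ t 0
      ≈⟨ ℚᵘP.+-congˡ (mkℚᵘ t 0) (ℚᵘP.+-cong (ℚP.toℚᵘ-homo-* (ι (r ℤ.* s)) (x * x * x)) (ℚP.toℚᵘ-homo-* (ι s) x)) ⟩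
    toℚᵘ (ι (r ℤ.* s)) ℚᵘ.* toℚᵘ (x * x * x) ℚᵘ.+ toℚᵘ (ι s) ℚᵘ.* X ℚᵘ.+ mkℚᵘ t 0
      ≈⟨ ℚᵘP.+-congˡ (mkℚᵘ t 0) (ℚᵘP.+-cong (ℚᵘP.*-cong (ι-toℚᵘ (r ℤ.* s)) cube) (ℚᵘP.*-congʳ {X} (ι-toℚᵘ s))) ⟩
    mkℚᵘ (r ℤ.* s) 0 ℚᵘ.* (X ℚᵘ.* X ℚᵘ.* X) ℚᵘ.+ mkℚᵘ s 0 ℚᵘ.* X ℚᵘ.+ mkℚᵘ t 0 ∎
    where
    open ℚᵘP.≃-Reasoning
    X = toℚᵘ x
    y = φ r s t x
    cube : toℚᵘ (x * x * x) ≃ X ℚᵘ.* X ℚᵘ.* X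
    cube = ℚᵘP.≃-trans (ℚP.toℚᵘ-homo-* (x * x) x) (ℚᵘP.*-congʳ {X} (ℚP.toℚᵘ-homo-* x x))

-- Cross-multiplying in ℚᵘ, where fractions stay unreduced, gives this identity times d³.
φ-cross : ∀ r s t x →
  ℚ.↥ (φ r s t x) ℤ.* φ-den (ℚ.↥ x) (ℚ.↧ x) ≡ φ-num r s t (ℚ.↥ x) (ℚ.↧ x) ℤ.* ℚ.↧ (φ r s t x)
φ-cross r s t x@(mkℚ a dm _) with φ r s t x | toℚᵘ-φ-cleared r s t x
... | mkℚ b em _ | *≡* eq = ℤP.*-cancelʳ-≡ _ _ (d ℤ.* d ℤ.* d) (begin
  b ℤ.* φ-den a d ℤ.* (d ℤ.* d ℤ.* d)
    ≡⟨ solve 3 (λ b a d → b :* (d :* (a :* a :+ d :* d)) :* (d :* d :* d) :=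
         (b :* ((a :* a) :* con (+ 1) :+ con (+ 1) :* (d :* d))) :* (((con (+ 1) :* ((d :* d) :* d)) :* (con (+ 1) :* d)) :* con (+ 1)))
         refl b a d ⟩
  _ ≡⟨ eq ⟩
  _ ≡⟨ solve 6 (λ r s t a d e →
         (((r :* s) :* ((a :* a) :* a) :* (con (+ 1) :* d) :+ (s :* a) :* (con (+ 1) :* ((d :* d) :* d))) :* con (+ 1)
           :+ t :* ((con (+ 1) :* ((d :* d) :* d)) :* (con (+ 1) :* d))) :* (e :* ((d :* d) :* con (+ 1)))
         := (r :* s :* (a :* a :* a) :+ s :* a :* (d :* d) :+ t :* (d :* d :* d)) :* e :* (d :* d :* d))
         refl r s t a d (+ suc em) ⟩
  φ-num r s t a d ℤ.* + suc em ℤ.* (d ℤ.* d ℤ.* d) ∎)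
  where
  open ≡-Reasoning
  d = + suc dm

φ≡ι⇒cross : ∀ r s t x z → φ r s t x ≡ ι z → z ℤ.* φ-den (ℚ.↥ x) (ℚ.↧ x) ≡ φ-num r s t (ℚ.↥ x) (ℚ.↧ x)
φ≡ι⇒cross r s t x z φx≡ιz = trans
  (subst₂ (λ u e → u ℤ.* φ-den (ℚ.↥ x) (ℚ.↧ x) ≡ φ-num r s t (ℚ.↥ x) (ℚ.↧ x) ℤ.* e) (ι-num z) (ι-den z)
    (subst (λ y → ℚ.↥ y ℤ.* φ-den (ℚ.↥ x) (ℚ.↧ x) ≡ φ-num r s t (ℚ.↥ x) (ℚ.↧ x) ℤ.* ℚ.↧ y) φx≡ιz (φ-cross r s t x)))
  (ℤP.*-identityʳ _)

-- Primes persisting in denominators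

prime∣*⇒∣⊎∣ : ∀ {p} → Prime p → ∀ i j → + p ∣ i ℤ.* j → + p ∣ i ⊎ + p ∣ j
prime∣*⇒∣⊎∣ pp i j p∣ij =
  Sum.map ∣ᵤ⇒∣ ∣ᵤ⇒∣ (euclidsLemma ℤ.∣ i ∣ ℤ.∣ j ∣ pp (subst (_ ℕD.∣_) (ℤP.abs-* i j) (∣⇒∣ᵤ p∣ij)))

prime∣cube⇒∣ : ∀ {p} → Prime p → ∀ i → + p ∣ i ℤ.* i ℤ.* i → + p ∣ i
prime∣cube⇒∣ pp i p∣i³ with prime∣*⇒∣⊎∣ pp (i ℤ.* i) i p∣i³
... | inj₂ p∣i = p∣i
... | inj₁ p∣i² = Sum.[ id , id ] (prime∣*⇒∣⊎∣ pp i i p∣i²)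

prime∤1 : ∀ {p} → Prime p → ¬ + p ∣ + 1
prime∤1 pp p∣1 = ¬prime[1] (subst Prime (ℕD.∣1⇒≡1 (∣⇒∣ᵤ p∣1)) pp)

prime-factor : ∀ n .{{_ : ℕ.NonZero n}} → n ≢ 1 → ∃[ p ] Prime p × p ℕD.∣ n
prime-factor n n≢1 with factorise n
... | record { factors = [] ; isFactorisation = n≡1 } = contradiction n≡1 n≢1
... | record { factors = p ∷ ps ; isFactorisation = n≡p*ps ; factorsPrime = pp ∷ _ } =
  p , pp , ℕD.divides (product ps) (trans n≡p*ps (ℕP.*-comm p (product ps)))

prime∤↥∧↧ : ∀ {p} → Prime p → ∀ x → + p ∣ ℚ.↥ x → ¬ + p ∣ ℚ.↧ x
prime∤↥∧↧ pp x@(mkℚ _ _ coprime) p∣↥ p∣↧ =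
  ¬prime[1] (subst Prime (NC.recompute coprime (∣⇒∣ᵤ p∣↥ , ∣⇒∣ᵤ p∣↧)) pp)

DenominatorPrimeNotDividing : ℤ → ℚ → Set
DenominatorPrimeNotDividing c x = ∃[ p ] Prime p × + p ∣ ℚ.↧ x × ¬ + p ∣ c

denominatorPrime⇒≢ι : ∀ {c x} → DenominatorPrimeNotDividing c x → ∀ z → x ≢ ι z
denominatorPrime⇒≢ι (p , pp , p∣↧ , _) z refl = prime∤1 pp (subst (+ p ∣_) (ι-den z) p∣↧)

denominatorPrime-intro : ∀ {c} x → ℚ.↧ₙ x ≢ 1 →
  (∀ {p} → Prime p → + p ∣ ℚ.↧ x → ¬ + p ∣ c) → DenominatorPrimeNotDividing c x
denominatorPrime-intro x ↧≢1 p∤c with prime-factor (ℚ.↧ₙ x) ↧≢1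
... | p , pp , p∣↧ = p , pp , ∣ᵤ⇒∣ p∣↧ , p∤c pp (∣ᵤ⇒∣ p∣↧)

-- Modulo p, φ-num ≡ rs a³ is nonzero while p ∣ d ∣ φ-den, so p passes to the new denominator.
φ-preserves-denominatorPrime : ∀ r s t x →
  DenominatorPrimeNotDividing (r ℤ.* s) x → DenominatorPrimeNotDividing (r ℤ.* s) (φ r s t x)
φ-preserves-denominatorPrime r s t x (p , pp , p∣d , p∤rs) = p , pp , p∣e , p∤rs
  where
  a = ℚ.↥ x
  d = ℚ.↧ x
  N = φ-num r s t a d
  N-split : N ≡ r ℤ.* s ℤ.* (a ℤ.* a ℤ.* a) ℤ.+ d ℤ.* (s ℤ.* a ℤ.* d ℤ.+ t ℤ.* (d ℤ.* d))
  N-split = solve 5 (λ r s t a d → r :* s :* (a :* a :* a) :+ s :* a :* (d :* d) :+ t :* (d :* d :* d)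
    := r :* s :* (a :* a :* a) :+ d :* (s :* a :* d :+ t :* (d :* d))) refl r s t a d
  p∤N : ¬ + p ∣ N
  p∤N p∣N = Sum.[ p∤rs , (λ p∣a³ → prime∤↥∧↧ pp x (prime∣cube⇒∣ pp a p∣a³) p∣d) ]
    (prime∣*⇒∣⊎∣ pp (r ℤ.* s) (a ℤ.* a ℤ.* a)
      (∣m+n∣n⇒∣m (subst (+ p ∣_) N-split p∣N) (∣m⇒∣m*n (s ℤ.* a ℤ.* d ℤ.+ t ℤ.* (d ℤ.* d)) p∣d)))
  p∣D : + p ∣ φ-den a d
  p∣D = ∣m⇒∣m*n (a ℤ.* a ℤ.+ d ℤ.* d) p∣d
  p∣e : + p ∣ ℚ.↧ (φ r s t x)
  p∣e = Sum.[ (λ p∣N → contradiction p∣N p∤N) , id ]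
    (prime∣*⇒∣⊎∣ pp N (ℚ.↧ (φ r s t x)) (subst (+ p ∣_) (φ-cross r s t x) (∣n⇒∣m*n (ℚ.↥ (φ r s t x)) p∣D)))

↧∣-cross-denominator : ∀ x D N → ℚ.↥ x ℤ.* D ≡ N ℤ.* ℚ.↧ x → ℚ.↧ x ∣ D
↧∣-cross-denominator x@(mkℚ _ _ coprime) D N cross = ∣ᵤ⇒∣ (ℤC.coprime-divisor (ℚ.↧ x) (ℚ.↥ x) D
  (NC.sym (NC.recompute coprime)) (∣⇒∣ᵤ (divides N cross)))

-- The denominator of φ(b) divides b² + 1, which is coprime to rs as rs ∣ b; it is not 1 as φ(b) ∉ ℤ.
φ-ι-denominatorPrime : ∀ r s t b → r ℤ.* s ∣ b → ¬ φ-den b (+ 1) ∣ φ-num r s t b (+ 1) →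
  DenominatorPrimeNotDividing (r ℤ.* s) (φ r s t (ι b))
φ-ι-denominatorPrime r s t b rs∣b D∤N = denominatorPrime-intro (φ r s t (ι b)) e≢1 p∤rs
  where
  y = φ r s t (ι b)
  D = φ-den b (+ 1)
  N = φ-num r s t b (+ 1)
  cross : ℚ.↥ y ℤ.* D ≡ N ℤ.* ℚ.↧ y
  cross = subst₂ (λ a d → ℚ.↥ y ℤ.* φ-den a d ≡ φ-num r s t a d ℤ.* ℚ.↧ y)
    (ι-num b) (ι-den b) (φ-cross r s t (ι b))
  e≢1 : ℚ.↧ₙ y ≢ 1
  e≢1 e≡1 = D∤N (divides (ℚ.↥ y) (sym (trans cross (trans (cong (λ e → N ℤ.* + e) e≡1) (ℤP.*-identityʳ N)))))
  p∤rs : ∀ {p} → Prime p → + p ∣ ℚ.↧ y → ¬ + p ∣ r ℤ.* s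
  p∤rs {p} pp p∣e p∣rs = prime∤1 pp (∣m+n∣m⇒∣n
    (subst (+ p ∣_) (ℤP.*-identityˡ (b ℤ.* b ℤ.+ + 1 ℤ.* + 1)) (∣-trans p∣e (↧∣-cross-denominator y D N cross)))
    (∣n⇒∣m*n b (∣-trans p∣rs rs∣b)))

-- φ(β) is not an integer

small-multiple≡0 : ∀ {m i} → m ∣ i → ℤ.∣ i ∣ ℕ.< ℤ.∣ m ∣ → i ≡ + 0
small-multiple≡0 {i = + 0}      _   _   = refl
small-multiple≡0 {i = +[1+ n ]} m∣i i<m = contradiction (ℕD.∣⇒≤ (∣⇒∣ᵤ m∣i)) (ℕP.<⇒≱ i<m)
small-multiple≡0 {i = -[1+ n ]} m∣i i<m = contradiction (ℕD.∣⇒≤ (∣⇒∣ᵤ m∣i)) (ℕP.<⇒≱ i<m)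

i*i≡∣i∣*∣i∣ : ∀ i → i ℤ.* i ≡ + (ℤ.∣ i ∣ ℕ.* ℤ.∣ i ∣)
i*i≡∣i∣*∣i∣ (+ n)    = sym (ℤP.pos-* n n)
i*i≡∣i∣*∣i∣ -[1+ n ] = refl

∣φ-den-at-integer∣ : ∀ b → ℤ.∣ φ-den b (+ 1) ∣ ≡ suc (ℤ.∣ b ∣ ℕ.* ℤ.∣ b ∣)
∣φ-den-at-integer∣ b = trans (cong ℤ.∣_∣ (trans
  (solve 1 (λ b → con (+ 1) :* (b :* b :+ con (+ 1) :* con (+ 1)) := b :* b :+ con (+ 1)) refl b)
  (cong (ℤ._+ + 1) (i*i≡∣i∣*∣i∣ b)))) (ℕP.+-comm _ 1)

remainder-small : ∀ R S T U .{{_ : ℕ.NonZero R}} .{{_ : ℕ.NonZero S}} .{{_ : ℕ.NonZero T}} →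
  4 ℕ.* (R ℕ.* S ℕ.* T) ℕ.≤ U → (S ℕ.+ R ℕ.* S) ℕ.* U ℕ.+ T ℕ.< suc (U ℕ.* U) × T ℕ.< U
remainder-small R S T U 4P≤U = ℕ.s≤s M≤U² , ℕP.<-≤-trans (ℕP.≤-<-trans T≤P P<4P) 4P≤U
  where
  open ℕP.≤-Reasoning
  P = R ℕ.* S ℕ.* T
  instance
    RS≢0 = ℕP.m*n≢0 R S
    P≢0 = ℕP.m*n≢0 (R ℕ.* S) T
  S≤P : S ℕ.≤ P
  S≤P = ℕP.≤-trans (ℕP.m≤n*m S R) (ℕP.m≤m*n (R ℕ.* S) T)
  RS≤P : R ℕ.* S ℕ.≤ P
  RS≤P = ℕP.m≤m*n (R ℕ.* S) T
  T≤P : T ℕ.≤ P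
  T≤P = ℕP.m≤n*m T (R ℕ.* S)
  P<4P : P ℕ.< 4 ℕ.* P
  P<4P = ℕP.<-≤-trans (ℕP.m<m*n P 4 (ℕ.s≤s (ℕ.s≤s ℕ.z≤n))) (ℕP.≤-reflexive (ℕP.*-comm P 4))
  P≤PU : P ℕ.≤ P ℕ.* U
  P≤PU = ℕP.m≤m*n P U {{ℕ.>-nonZero (ℕP.<-≤-trans (ℕP.≤-<-trans ℕ.z≤n P<4P) 4P≤U)}}
  M≤U² : (S ℕ.+ R ℕ.* S) ℕ.* U ℕ.+ T ℕ.≤ U ℕ.* U
  M≤U² = begin
    (S ℕ.+ R ℕ.* S) ℕ.* U ℕ.+ T ≤⟨ ℕP.+-mono-≤ (ℕP.*-monoˡ-≤ U (ℕP.+-mono-≤ S≤P RS≤P)) (ℕP.≤-trans T≤P P≤PU) ⟩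
    (P ℕ.+ P) ℕ.* U ℕ.+ P ℕ.* U ≤⟨ ℕP.m≤m+n _ (P ℕ.* U) ⟩
    (P ℕ.+ P) ℕ.* U ℕ.+ P ℕ.* U ℕ.+ P ℕ.* U ≡⟨ ℕS.solve 2 (λ P U → (P ℕS.:+ P) ℕS.:* U ℕS.:+ P ℕS.:* U ℕS.:+ P ℕS.:* U ℕS.:= ℕS.con 4 ℕS.:* P ℕS.:* U) refl P U ⟩
    4 ℕ.* P ℕ.* U ≤⟨ ℕP.*-monoˡ-≤ U 4P≤U ⟩
    U ℕ.* U ∎

-- φ-num = rs b φ-den + ((s − rs) b + t), and the remainder is too small to be a nonzero multiple
-- of φ-den; so it vanishes, giving b ∣ t with 0 < |t| < |b|.
φ-den∤φ-num-large : ∀ r s t b → r ≢ + 0 → s ≢ + 0 → t ≢ + 0 →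
  4 ℕ.* (ℤ.∣ r ∣ ℕ.* ℤ.∣ s ∣ ℕ.* ℤ.∣ t ∣) ℕ.≤ ℤ.∣ b ∣ → ¬ φ-den b (+ 1) ∣ φ-num r s t b (+ 1)
φ-den∤φ-num-large r s t b r≢0 s≢0 t≢0 4P≤U D∣N = t≢0 (small-multiple≡0 b∣t T<U)
  where
  open ℕP.≤-Reasoning
  R = ℤ.∣ r ∣
  S = ℤ.∣ s ∣
  T = ℤ.∣ t ∣
  U = ℤ.∣ b ∣
  sizes : (S ℕ.+ R ℕ.* S) ℕ.* U ℕ.+ T ℕ.< suc (U ℕ.* U) × T ℕ.< U
  sizes = remainder-small R S T U {{ℤ.≢-nonZero r≢0}} {{ℤ.≢-nonZero s≢0}} {{ℤ.≢-nonZero t≢0}} 4P≤U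
  T<U : T ℕ.< U
  T<U = proj₂ sizes
  D = φ-den b (+ 1)
  N = φ-num r s t b (+ 1)
  c = s ℤ.- r ℤ.* s
  M = c ℤ.* b ℤ.+ t
  M≡N-rsbD : M ≡ N ℤ.- r ℤ.* s ℤ.* b ℤ.* D
  M≡N-rsbD = solve 4 (λ r s t b → (s :- r :* s) :* b :+ t :=
    r :* s :* (b :* b :* b) :+ s :* b :* (con (+ 1) :* con (+ 1)) :+ t :* (con (+ 1) :* con (+ 1) :* con (+ 1))
      :- r :* s :* b :* (con (+ 1) :* (b :* b :+ con (+ 1) :* con (+ 1)))) refl r s t b
  ∣M∣<∣D∣ : ℤ.∣ M ∣ ℕ.< ℤ.∣ D ∣
  ∣M∣<∣D∣ = begin-strict
    ℤ.∣ M ∣                 ≤⟨ ℤP.∣i+j∣≤∣i∣+∣j∣ (c ℤ.* b) t ⟩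
    ℤ.∣ c ℤ.* b ∣ ℕ.+ T      ≡⟨ cong (ℕ._+ T) (ℤP.abs-* c b) ⟩
    ℤ.∣ c ∣ ℕ.* U ℕ.+ T      ≤⟨ ℕP.+-monoˡ-≤ T (ℕP.*-monoˡ-≤ U (ℕP.≤-trans (ℤP.∣i-j∣≤∣i∣+∣j∣ s (r ℤ.* s))
                                 (ℕP.≤-reflexive (cong (S ℕ.+_) (ℤP.abs-* r s))))) ⟩
    (S ℕ.+ R ℕ.* S) ℕ.* U ℕ.+ T <⟨ proj₁ sizes ⟩
    suc (U ℕ.* U)            ≡⟨ sym (∣φ-den-at-integer∣ b) ⟩
    ℤ.∣ D ∣                  ∎
  M≡0 : M ≡ + 0
  M≡0 = small-multiple≡0 (subst (D ∣_) (sym M≡N-rsbD) (∣m∣n⇒∣m-n D∣N (∣n⇒∣m*n (r ℤ.* s ℤ.* b) ∣-refl))) ∣M∣<∣D∣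
  b∣t : b ∣ t
  b∣t = ∣m+n∣m⇒∣n (subst (b ∣_) (sym M≡0) (divides (+ 0) refl)) (∣n⇒∣m*n c ∣-refl)

2∣unit-1 : ∀ u → ℤ.∣ u ∣ ≡ 1 → + 2 ∣ u ℤ.- + 1
2∣unit-1 (+ .1)      refl = divides (+ 0) refl
2∣unit-1 -[1+ zero ] refl = divides -[1+ 0 ] refl

unit-* : ∀ u v → ℤ.∣ u ∣ ≡ 1 → ℤ.∣ v ∣ ≡ 1 → ℤ.∣ u ℤ.* v ∣ ≡ 1
unit-* u v ∣u∣≡1 ∣v∣≡1 = trans (ℤP.abs-* u v) (cong₂ ℕ._*_ ∣u∣≡1 ∣v∣≡1)

2∣φ-den-at-unit : ∀ b → ℤ.∣ b ∣ ≡ 1 → + 2 ∣ φ-den b (+ 1)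
2∣φ-den-at-unit (+ .1)      refl = ∣-refl
2∣φ-den-at-unit -[1+ zero ] refl = ∣-refl

-- Here φ-den = 2, while φ-num is a sum of three odd numbers.
φ-den∤φ-num-unit : ∀ r s t b → ℤ.∣ r ∣ ≡ 1 → ℤ.∣ s ∣ ≡ 1 → ℤ.∣ t ∣ ≡ 1 → ℤ.∣ b ∣ ≡ 1 →
  ¬ φ-den b (+ 1) ∣ φ-num r s t b (+ 1)
φ-den∤φ-num-unit r s t b ∣r∣≡1 ∣s∣≡1 ∣t∣≡1 ∣b∣≡1 D∣N =
  from-no (2 ℕD.∣? 3) (∣⇒∣ᵤ (subst (+ 2 ∣_) N-[N-3]≡3 (∣m∣n⇒∣m-n 2∣N 2∣N-3)))
  where
  N = φ-num r s t b (+ 1)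
  2∣N : + 2 ∣ N
  2∣N = ∣-trans (2∣φ-den-at-unit b ∣b∣≡1) D∣N
  rsb³ : ℤ
  rsb³ = r ℤ.* s ℤ.* (b ℤ.* b ℤ.* b)
  N-3≡ : N ℤ.- + 3 ≡ (rsb³ ℤ.- + 1) ℤ.+ (s ℤ.* b ℤ.- + 1) ℤ.+ (t ℤ.- + 1)
  N-3≡ = solve 4 (λ r s t b →
    r :* s :* (b :* b :* b) :+ s :* b :* (con (+ 1) :* con (+ 1)) :+ t :* (con (+ 1) :* con (+ 1) :* con (+ 1)) :- con (+ 3)
      := (r :* s :* (b :* b :* b) :- con (+ 1)) :+ (s :* b :- con (+ 1)) :+ (t :- con (+ 1))) refl r s t b
  ∣rsb³∣≡1 : ℤ.∣ rsb³ ∣ ≡ 1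
  ∣rsb³∣≡1 = unit-* (r ℤ.* s) (b ℤ.* b ℤ.* b) (unit-* r s ∣r∣≡1 ∣s∣≡1)
    (unit-* (b ℤ.* b) b (unit-* b b ∣b∣≡1 ∣b∣≡1) ∣b∣≡1)
  2∣N-3 : + 2 ∣ N ℤ.- + 3
  2∣N-3 = subst (+ 2 ∣_) (sym N-3≡) (∣m∣n⇒∣m+n (∣m∣n⇒∣m+n
    (2∣unit-1 rsb³ ∣rsb³∣≡1) (2∣unit-1 (s ℤ.* b) (unit-* s b ∣s∣≡1 ∣b∣≡1))) (2∣unit-1 t ∣t∣≡1))
  N-[N-3]≡3 : N ℤ.- (N ℤ.- + 3) ≡ + 3
  N-[N-3]≡3 = solve 1 (λ N → N :- (N :- con (+ 3)) := con (+ 3)) refl N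

∣i^n∣≡∣i∣^n : ∀ i n → ℤ.∣ i ℤ.^ n ∣ ≡ ℤ.∣ i ∣ ℕ.^ n
∣i^n∣≡∣i∣^n i zero    = refl
∣i^n∣≡∣i∣^n i (suc n) = trans (ℤP.abs-* i (i ℤ.^ n)) (cong (ℤ.∣ i ∣ ℕ.*_) (∣i^n∣≡∣i∣^n i n))

∣β∣ : ∀ n₁ n₂ n₃ r s t →
  ℤ.∣ β n₁ n₂ n₃ r s t ∣ ≡ ℤ.∣ r ∣ ℕ.^ n₁ ℕ.* ℤ.∣ s ∣ ℕ.^ n₂ ℕ.* ℤ.∣ t ∣ ℕ.^ n₃
∣β∣ n₁ n₂ n₃ r s t = begin
  ℤ.∣ r ℤ.^ n₁ ℤ.* s ℤ.^ n₂ ℤ.* t ℤ.^ n₃ ∣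
    ≡⟨ ℤP.abs-* (r ℤ.^ n₁ ℤ.* s ℤ.^ n₂) (t ℤ.^ n₃) ⟩
  ℤ.∣ r ℤ.^ n₁ ℤ.* s ℤ.^ n₂ ∣ ℕ.* ℤ.∣ t ℤ.^ n₃ ∣
    ≡⟨ cong₂ ℕ._*_ (ℤP.abs-* (r ℤ.^ n₁) (s ℤ.^ n₂)) (∣i^n∣≡∣i∣^n t n₃) ⟩
  ℤ.∣ r ℤ.^ n₁ ∣ ℕ.* ℤ.∣ s ℤ.^ n₂ ∣ ℕ.* ℤ.∣ t ∣ ℕ.^ n₃
    ≡⟨ cong (ℕ._* ℤ.∣ t ∣ ℕ.^ n₃) (cong₂ ℕ._*_ (∣i^n∣≡∣i∣^n r n₁) (∣i^n∣≡∣i∣^n s n₂)) ⟩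
  ℤ.∣ r ∣ ℕ.^ n₁ ℕ.* ℤ.∣ s ∣ ℕ.^ n₂ ℕ.* ℤ.∣ t ∣ ℕ.^ n₃ ∎
  where open ≡-Reasoning

4m≤m³ : ∀ {m} → 2 ℕ.≤ m → 4 ℕ.* m ℕ.≤ m ℕ.^ 3
4m≤m³ {m} 2≤m = ℕP.≤-trans (ℕP.*-monoˡ-≤ m (ℕP.*-mono-≤ 2≤m 2≤m))
  (ℕP.≤-reflexive (ℕS.solve 1 (λ m → m ℕS.:* m ℕS.:* m ℕS.:= m ℕS.:^ 3) refl m))

cube≤powers : ∀ {n₁ n₂ n₃} R S T .{{_ : ℕ.NonZero R}} .{{_ : ℕ.NonZero S}} .{{_ : ℕ.NonZero T}} →
  3 ℕ.≤ n₁ → 3 ℕ.≤ n₂ → 3 ℕ.≤ n₃ → (R ℕ.* S ℕ.* T) ℕ.^ 3 ℕ.≤ R ℕ.^ n₁ ℕ.* S ℕ.^ n₂ ℕ.* T ℕ.^ n₃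
cube≤powers R S T 3≤n₁ 3≤n₂ 3≤n₃ = ℕP.≤-trans
  (ℕP.≤-reflexive (ℕS.solve 3 (λ R S T → (R ℕS.:* S ℕS.:* T) ℕS.:^ 3 ℕS.:= R ℕS.:^ 3 ℕS.:* S ℕS.:^ 3 ℕS.:* T ℕS.:^ 3) refl R S T))
  (ℕP.*-mono-≤ (ℕP.*-mono-≤ (ℕP.^-monoʳ-≤ R 3≤n₁) (ℕP.^-monoʳ-≤ S 3≤n₂)) (ℕP.^-monoʳ-≤ T 3≤n₃))

φ-den∤φ-num-β : ∀ {n₁ n₂ n₃} r s t → 3 ℕ.≤ n₁ → 3 ℕ.≤ n₂ → 3 ℕ.≤ n₃ → r ≢ + 0 → s ≢ + 0 → t ≢ + 0 →
  ¬ φ-den (β n₁ n₂ n₃ r s t) (+ 1) ∣ φ-num r s t (β n₁ n₂ n₃ r s t) (+ 1)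
φ-den∤φ-num-β {n₁} {n₂} {n₃} r s t 3≤n₁ 3≤n₂ 3≤n₃ r≢0 s≢0 t≢0 =
  Sum.[ large , unit ]′ (ℕP.m≤n⇒m<n∨m≡n (ℕ.>-nonZero⁻¹ P))
  where
  R = ℤ.∣ r ∣
  S = ℤ.∣ s ∣
  T = ℤ.∣ t ∣
  P = R ℕ.* S ℕ.* T
  b = β n₁ n₂ n₃ r s t
  instance
    R≢0 = ℤ.≢-nonZero r≢0
    S≢0 = ℤ.≢-nonZero s≢0
    T≢0 = ℤ.≢-nonZero t≢0
    P≢0 = ℕP.m*n≢0 (R ℕ.* S) T {{ℕP.m*n≢0 R S}}
  large : 1 ℕ.< P → ¬ φ-den b (+ 1) ∣ φ-num r s t b (+ 1)
  large 1<P = φ-den∤φ-num-large r s t b r≢0 s≢0 t≢0 (begin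
    4 ℕ.* P                                   ≤⟨ 4m≤m³ 1<P ⟩
    P ℕ.^ 3                                   ≤⟨ cube≤powers R S T 3≤n₁ 3≤n₂ 3≤n₃ ⟩
    R ℕ.^ n₁ ℕ.* S ℕ.^ n₂ ℕ.* T ℕ.^ n₃        ≡⟨ sym (∣β∣ n₁ n₂ n₃ r s t) ⟩
    ℤ.∣ b ∣                                   ∎)
    where open ℕP.≤-Reasoning
  unit : 1 ≡ P → ¬ φ-den b (+ 1) ∣ φ-num r s t b (+ 1)
  unit 1≡P = φ-den∤φ-num-unit r s t b R≡1 S≡1 T≡1 (begin
    ℤ.∣ b ∣                            ≡⟨ ∣β∣ n₁ n₂ n₃ r s t ⟩
    R ℕ.^ n₁ ℕ.* S ℕ.^ n₂ ℕ.* T ℕ.^ n₃ ≡⟨ cong₂ ℕ._*_ (cong₂ ℕ._*_ (cong (ℕ._^ n₁) R≡1) (cong (ℕ._^ n₂) S≡1)) (cong (ℕ._^ n₃) T≡1) ⟩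
    1 ℕ.^ n₁ ℕ.* 1 ℕ.^ n₂ ℕ.* 1 ℕ.^ n₃ ≡⟨ cong₂ ℕ._*_ (cong₂ ℕ._*_ (ℕP.^-zeroˡ n₁) (ℕP.^-zeroˡ n₂)) (ℕP.^-zeroˡ n₃) ⟩
    1                                  ∎)
    where
    open ≡-Reasoning
    RS≡1 : R ℕ.* S ≡ 1
    RS≡1 = ℕP.m*n≡1⇒m≡1 (R ℕ.* S) T (sym 1≡P)
    R≡1 : R ≡ 1
    R≡1 = ℕP.m*n≡1⇒m≡1 R S RS≡1
    S≡1 : S ≡ 1
    S≡1 = ℕP.m*n≡1⇒n≡1 R S RS≡1
    T≡1 : T ≡ 1
    T≡1 = ℕP.m*n≡1⇒n≡1 (R ℕ.* S) T (sym 1≡P)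

-- Integer points of the orbits

iter-preserves : ∀ (P : ℚ → Set) f x → (∀ y → P y → P (f y)) → P (f x) → ∀ n → P (iter f (suc n) x)
iter-preserves P f x pres Pfx zero    = Pfx
iter-preserves P f x pres Pfx (suc n) = pres _ (iter-preserves P f x pres Pfx n)

iter-fixed : ∀ {f x} → f x ≡ x → ∀ n → iter f n x ≡ x
iter-fixed         fx≡x zero    = refl
iter-fixed {f} fx≡x (suc n) = trans (cong f (iter-fixed fx≡x n)) fx≡x

rs∣β : ∀ m₁ m₂ n₃ r s t → r ℤ.* s ∣ β (suc m₁) (suc m₂) n₃ r s t
rs∣β m₁ m₂ n₃ r s t = divides (r ℤ.^ m₁ ℤ.* s ℤ.^ m₂ ℤ.* t ℤ.^ n₃)
  (solve 5 (λ r s a b c → r :* a :* (s :* b) :* c := a :* b :* c :* (r :* s)) refl r s (r ℤ.^ m₁) (s ℤ.^ m₂) (t ℤ.^ n₃))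

orbit-integers≡β : ∀ {n₁ n₂ n₃} r s t → 3 ℕ.≤ n₁ → 3 ℕ.≤ n₂ → 3 ℕ.≤ n₃ → r ≢ + 0 → s ≢ + 0 → t ≢ + 0 →
  ∀ z → InOrbit (φ r s t) (ι (β n₁ n₂ n₃ r s t)) (ι z) → z ≡ β n₁ n₂ n₃ r s t
orbit-integers≡β {n₁} {n₂} {n₃} r s t _ _ _ _ _ _ z (zero , ιβ≡ιz) = sym (ι-injective (β n₁ n₂ n₃ r s t) z ιβ≡ιz)
orbit-integers≡β {n₁@(suc m₁)} {n₂@(suc m₂)} {n₃} r s t 3≤n₁@(ℕ.s≤s _) 3≤n₂@(ℕ.s≤s _) 3≤n₃ r≢0 s≢0 t≢0 z (suc n , eq) =
  contradiction eq (denominatorPrime⇒≢ι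
    (iter-preserves (DenominatorPrimeNotDividing (r ℤ.* s)) (φ r s t) (ι b) (φ-preserves-denominatorPrime r s t)
      (φ-ι-denominatorPrime r s t b (rs∣β m₁ m₂ n₃ r s t) (φ-den∤φ-num-β r s t 3≤n₁ 3≤n₂ 3≤n₃ r≢0 s≢0 t≢0)) n) z)
  where
  b : ℤ
  b = β n₁ n₂ n₃ r s t

φ-fixes-0 : ∀ r s → φ r s (+ 0) (ι (+ 0)) ≡ ι (+ 0)
φ-fixes-0 r s = trans (cong (ℚ._* w⁻¹) (cong₂ (λ u v → u ℚ.+ v ℚ.+ ι (+ 0)) (ℚP.*-zeroʳ (ι (r ℤ.* s))) (ℚP.*-zeroʳ (ι s))))
  (ℚP.*-zeroˡ w⁻¹)
  where w⁻¹ = ℚ.1/_ (ι (+ 0) ℚ.* ι (+ 0) ℚ.+ 1ℚ) {{sq+1-nonZero (ι (+ 0))}}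

orbit-of-0-integers : ∀ r s z → InOrbit (φ r s (+ 0)) (ι (+ 0)) (ι z) → z ≡ + 0
orbit-of-0-integers r s z (n , eq) = sym (ι-injective (+ 0) z (trans (sym (iter-fixed (φ-fixes-0 r s) n)) eq))

orbit-integers-off-axes : ∀ {n₁ n₂ n₃} r s t → 3 ℕ.≤ n₁ → 3 ℕ.≤ n₂ → 3 ℕ.≤ n₃ → r ≢ + 0 → s ≢ + 0 →
  ∀ z → InOrbit (φ r s t) (ι (β n₁ n₂ n₃ r s t)) (ι z) → z ≡ β n₁ n₂ n₃ r s t
orbit-integers-off-axes {n₁} {n₂} {suc m₃} r s (+ 0) _ _ _ _ _ z orbit =
  trans (orbit-of-0-integers r s z (subst (λ b → InOrbit _ (ι b) (ι z)) β≡0 orbit)) (sym β≡0)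
  where
  β≡0 : β n₁ n₂ (suc m₃) r s (+ 0) ≡ + 0
  β≡0 = ℤP.*-zeroʳ (r ℤ.^ n₁ ℤ.* s ℤ.^ n₂)
orbit-integers-off-axes r s t@(+[1+ _ ]) 3≤n₁ 3≤n₂ 3≤n₃ r≢0 s≢0 =
  orbit-integers≡β r s t 3≤n₁ 3≤n₂ 3≤n₃ r≢0 s≢0 (λ ())
orbit-integers-off-axes r s t@(-[1+ _ ]) 3≤n₁ 3≤n₂ 3≤n₃ r≢0 s≢0 =
  orbit-integers≡β r s t 3≤n₁ 3≤n₂ 3≤n₃ r≢0 s≢0 (λ ())

m*n≤m*m+n*n : ∀ m n → m ℕ.* n ℕ.≤ m ℕ.* m ℕ.+ n ℕ.* n
m*n≤m*m+n*n m n = Sum.[ (λ m≤n → ℕP.≤-trans (ℕP.*-monoˡ-≤ n m≤n) (ℕP.m≤n+m (n ℕ.* n) (m ℕ.* m)))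
                     , (λ n≤m → ℕP.≤-trans (ℕP.*-monoʳ-≤ m n≤m) (ℕP.m≤m+n (m ℕ.* m) (n ℕ.* n))) ]′
                     (ℕP.≤-total m n)

cleared-numerator-bound : ∀ S T A E →
  S ℕ.* A ℕ.* (E ℕ.* E) ℕ.+ T ℕ.* (E ℕ.* E ℕ.* E) ℕ.≤ (S ℕ.+ T) ℕ.* (E ℕ.* (A ℕ.* A ℕ.+ E ℕ.* E))
cleared-numerator-bound S T A E = begin
  S ℕ.* A ℕ.* (E ℕ.* E) ℕ.+ T ℕ.* (E ℕ.* E ℕ.* E)
    ≡⟨ ℕS.solve 4 (λ S T A E → S ℕS.:* A ℕS.:* (E ℕS.:* E) ℕS.:+ T ℕS.:* (E ℕS.:* E ℕS.:* E)
         ℕS.:= S ℕS.:* (A ℕS.:* E) ℕS.:* E ℕS.:+ T ℕS.:* (E ℕS.:* E) ℕS.:* E) refl S T A E ⟩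
  S ℕ.* (A ℕ.* E) ℕ.* E ℕ.+ T ℕ.* (E ℕ.* E) ℕ.* E
    ≤⟨ ℕP.+-mono-≤ (ℕP.*-monoˡ-≤ E (ℕP.*-monoʳ-≤ S (m*n≤m*m+n*n A E)))
                   (ℕP.*-monoˡ-≤ E (ℕP.*-monoʳ-≤ T (ℕP.m≤n+m (E ℕ.* E) (A ℕ.* A)))) ⟩
  S ℕ.* Q ℕ.* E ℕ.+ T ℕ.* Q ℕ.* E
    ≡⟨ ℕS.solve 4 (λ S T Q E → S ℕS.:* Q ℕS.:* E ℕS.:+ T ℕS.:* Q ℕS.:* E ℕS.:= (S ℕS.:+ T) ℕS.:* (E ℕS.:* Q)) refl S T Q E ⟩
  (S ℕ.+ T) ℕ.* (E ℕ.* Q) ∎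
  where
  open ℕP.≤-Reasoning
  Q = A ℕ.* A ℕ.+ E ℕ.* E

φ-integer-value-bound : ∀ r s t x z → r ℤ.* s ≡ + 0 → φ r s t x ≡ ι z → ℤ.∣ z ∣ ℕ.≤ ℤ.∣ s ∣ ℕ.+ ℤ.∣ t ∣
φ-integer-value-bound r s t x@(mkℚ a dm _) z rs≡0 φx≡ιz =
  ℕP.*-cancelʳ-≤ ℤ.∣ z ∣ (S ℕ.+ T) (E ℕ.* (A ℕ.* A ℕ.+ E ℕ.* E))
    {{ℕP.m*n≢0 E _ {{_}} {{ℕ.>-nonZero (ℕP.<-≤-trans ℕ.z<s (ℕP.m≤n+m (E ℕ.* E) (A ℕ.* A)))}}}} (begin
    ℤ.∣ z ∣ ℕ.* (E ℕ.* (A ℕ.* A ℕ.+ E ℕ.* E)) ≡⟨ cong (ℤ.∣ z ∣ ℕ.*_) (sym ∣D∣≡) ⟩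
    ℤ.∣ z ∣ ℕ.* ℤ.∣ D ∣                   ≡⟨ sym (ℤP.abs-* z D) ⟩
    ℤ.∣ z ℤ.* D ∣                          ≡⟨ cong ℤ.∣_∣ zD≡N ⟩
    ℤ.∣ s ℤ.* a ℤ.* (d ℤ.* d) ℤ.+ t ℤ.* (d ℤ.* d ℤ.* d) ∣
      ≤⟨ ℤP.∣i+j∣≤∣i∣+∣j∣ (s ℤ.* a ℤ.* (d ℤ.* d)) (t ℤ.* (d ℤ.* d ℤ.* d)) ⟩
    ℤ.∣ s ℤ.* a ℤ.* (d ℤ.* d) ∣ ℕ.+ ℤ.∣ t ℤ.* (d ℤ.* d ℤ.* d) ∣
      ≡⟨ cong₂ ℕ._+_
           (trans (ℤP.abs-* (s ℤ.* a) (d ℤ.* d)) (cong₂ ℕ._*_ (ℤP.abs-* s a) (ℤP.abs-* d d)))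
           (trans (ℤP.abs-* t (d ℤ.* d ℤ.* d)) (cong (T ℕ.*_) (trans (ℤP.abs-* (d ℤ.* d) d) (cong (ℕ._* E) (ℤP.abs-* d d))))) ⟩
    S ℕ.* A ℕ.* (E ℕ.* E) ℕ.+ T ℕ.* (E ℕ.* E ℕ.* E) ≤⟨ cleared-numerator-bound S T A E ⟩
    (S ℕ.+ T) ℕ.* (E ℕ.* (A ℕ.* A ℕ.+ E ℕ.* E))   ∎)
  where
  open ℕP.≤-Reasoning
  S = ℤ.∣ s ∣
  T = ℤ.∣ t ∣
  A = ℤ.∣ a ∣
  E = suc dm
  d = + E
  D = φ-den a d
  ∣D∣≡ : ℤ.∣ D ∣ ≡ E ℕ.* (A ℕ.* A ℕ.+ E ℕ.* E)
  ∣D∣≡ = trans (ℤP.abs-* d (a ℤ.* a ℤ.+ d ℤ.* d)) (cong (λ q → E ℕ.* ℤ.∣ q ∣) (cong₂ ℤ._+_ (i*i≡∣i∣*∣i∣ a) (i*i≡∣i∣*∣i∣ d)))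
  zD≡N : z ℤ.* D ≡ s ℤ.* a ℤ.* (d ℤ.* d) ℤ.+ t ℤ.* (d ℤ.* d ℤ.* d)
  zD≡N = trans (φ≡ι⇒cross r s t x z φx≡ιz) (trans
    (cong (λ c → c ℤ.* (a ℤ.* a ℤ.* a) ℤ.+ s ℤ.* a ℤ.* (d ℤ.* d) ℤ.+ t ℤ.* (d ℤ.* d ℤ.* d)) rs≡0)
    (solve 3 (λ a X Y → con (+ 0) :* (a :* a :* a) :+ X :+ Y := X :+ Y) refl a (s ℤ.* a ℤ.* (d ℤ.* d)) (t ℤ.* (d ℤ.* d ℤ.* d))))

β-on-axes : ∀ m₁ m₂ n₃ r s t → r ℤ.* s ≡ + 0 → β (suc m₁) (suc m₂) n₃ r s t ≡ + 0
β-on-axes m₁ m₂ n₃ r s t rs≡0 with ℤP.i*j≡0⇒i≡0∨j≡0 r rs≡0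
... | inj₁ refl = refl
... | inj₂ refl = cong (ℤ._* t ℤ.^ n₃) (ℤP.*-zeroʳ (r ℤ.^ suc m₁))

orbit-integers-on-axes : ∀ {n₁ n₂ n₃} r s t → 1 ℕ.≤ n₁ → 1 ℕ.≤ n₂ → r ℤ.* s ≡ + 0 →
  ∀ z → InOrbit (φ r s t) (ι (β n₁ n₂ n₃ r s t)) (ι z) → ℤ.∣ z ∣ ℕ.≤ ℤ.∣ s ∣ ℕ.+ ℤ.∣ t ∣
orbit-integers-on-axes {suc m₁} {suc m₂} {n₃} r s t _ _ rs≡0 z (zero , ιβ≡ιz) =
  ℕP.≤-trans (ℕP.≤-reflexive (cong ℤ.∣_∣ (trans (sym (ι-injective (β (suc m₁) (suc m₂) n₃ r s t) z ιβ≡ιz)) (β-on-axes m₁ m₂ n₃ r s t rs≡0)))) z≤n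
orbit-integers-on-axes r s t _ _ rs≡0 z (suc n , φx≡ιz) = φ-integer-value-bound r s t _ z rs≡0 φx≡ιz

-- Counting over the box

sum-map-≤ : ∀ {A : Set} {xs : List A} (g : A → ℕ) a → (∀ {x} → x ∈ xs → g x ℕ.≤ a) → sum (map g xs) ℕ.≤ length xs ℕ.* a
sum-map-≤ {xs = []}     g a _   = z≤n
sum-map-≤ {xs = x ∷ xs} g a ≤a = ℕP.+-mono-≤ (≤a (here refl)) (sum-map-≤ g a (≤a ∘ there))

module _ {A : Set} (_≟_ : DecidableEquality A) where

  Unique-length-≤ : ∀ {xs ys : List A} → Unique xs → (∀ {z} → z ∈ xs → z ∈ ys) → length xs ℕ.≤ length ys
  Unique-length-≤ {[]}     _             _     = z≤n
  Unique-length-≤ {x ∷ xs} {ys} (x∉xs ∷ !xs) xs⊆ys = ℕP.<-≤-trans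
    (s≤s (Unique-length-≤ !xs (λ z∈xs → ∈-filter⁺ (λ y → ¬? (x ≟ y)) (xs⊆ys (there z∈xs)) (All.lookup x∉xs z∈xs))))
    (filter-< (xs⊆ys (here refl)))
    where
    filter-< : x ∈ ys → length (filter (λ y → ¬? (x ≟ y)) ys) ℕ.< length ys
    filter-< x∈ys = List.filter-notAll (λ y → ¬? (x ≟ y)) ys (Any.map (λ x≡y x≢y → x≢y x≡y) x∈ys)

  sum-map-≤-except : ∀ {xs : List A} (g : A → ℕ) a c x₀ → Unique xs →
    (∀ {x} → x ∈ xs → g x ℕ.≤ a ℕ.+ c) → (∀ {x} → x ∈ xs → x ≢ x₀ → g x ℕ.≤ a) →
    sum (map g xs) ℕ.≤ length xs ℕ.* a ℕ.+ c
  sum-map-≤-except {[]} g a c x₀ _ _ _ = z≤n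
  sum-map-≤-except {x ∷ xs} g a c x₀ (x∉xs ∷ !xs) ≤a+c ≤a with x ≟ x₀
  ... | yes refl = ℕP.≤-trans
    (ℕP.+-mono-≤ (≤a+c (here refl)) (sum-map-≤ g a (λ y∈xs → ≤a (there y∈xs) (λ { refl → All.lookup x∉xs y∈xs refl }))))
    (ℕP.≤-reflexive (ℕS.solve 3 (λ a c n → a ℕS.:+ c ℕS.:+ n ℕS.:* a ℕS.:= a ℕS.:+ n ℕS.:* a ℕS.:+ c) refl a c (length xs)))
  ... | no x≢x₀ = ℕP.≤-trans
    (ℕP.+-mono-≤ (≤a (here refl) x≢x₀) (sum-map-≤-except g a c x₀ !xs (≤a+c ∘ there) (≤a ∘ there)))
    (ℕP.≤-reflexive (sym (ℕP.+-assoc a (length xs ℕ.* a) c)))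

length-range : ∀ M → length (range M) ≡ suc (2 ℕ.* M)
length-range M = trans (List.length-map _ (upTo (suc (2 ℕ.* M)))) (List.length-upTo (suc (2 ℕ.* M)))

⊖∈range : ∀ M i → i ℕ.≤ 2 ℕ.* M → i ⊖ M ∈ range M
⊖∈range M i i≤2M = subst (_∈ range M) (ℤP.m-n≡m⊖n i M) (∈-map⁺ (λ j → + j ℤ.- + M) (∈-upTo⁺ (s≤s i≤2M)))

2*M≡M+M : ∀ M → 2 ℕ.* M ≡ M ℕ.+ M
2*M≡M+M M = cong (M ℕ.+_) (ℕP.+-identityʳ M)

∣⊖∣≤ : ∀ M i → i ℕ.≤ 2 ℕ.* M → ℤ.∣ i ⊖ M ∣ ℕ.≤ M
∣⊖∣≤ M i i≤2M with ℕP.≤-total i M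
... | inj₁ i≤M = ℕP.≤-trans (ℕP.≤-reflexive (ℤP.∣⊖∣-≤ i≤M)) (ℕP.m∸n≤m M i)
... | inj₂ M≤i = ℕP.≤-trans (ℕP.≤-reflexive (trans (ℤP.∣m⊖n∣≡∣n⊖m∣ i M) (ℤP.∣⊖∣-≤ M≤i)))
                            (ℕP.m≤n+o⇒m∸n≤o i M (ℕP.≤-trans i≤2M (ℕP.≤-reflexive (2*M≡M+M M))))

∈range⇔ : ∀ M z → z ∈ range M ⇔ ℤ.∣ z ∣ ℕ.≤ M
∈range⇔ M z = mk⇔ to (from z)
  where
  to : z ∈ range M → ℤ.∣ z ∣ ℕ.≤ M
  to z∈ with ∈-map⁻ (λ j → + j ℤ.- + M) z∈
  ... | i , i∈ , refl = subst (λ w → ℤ.∣ w ∣ ℕ.≤ M) (sym (ℤP.m-n≡m⊖n i M)) (∣⊖∣≤ M i (ℕP.≤-pred (∈-upTo⁻ i∈)))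
  from : ∀ z → ℤ.∣ z ∣ ℕ.≤ M → z ∈ range M
  from (+ n) n≤M = subst (_∈ range M)
    (trans (ℤP.⊖-≥ (ℕP.m≤n+m M n)) (cong +_ (ℕP.m+n∸n≡m n M)))
    (⊖∈range M (n ℕ.+ M) (ℕP.≤-trans (ℕP.+-monoˡ-≤ M n≤M) (ℕP.≤-reflexive (sym (2*M≡M+M M)))))
  from -[1+ n ] n<M = subst (_∈ range M)
    (trans (ℤP.⊖-≤ (ℕP.m∸n≤m M (suc n))) (cong (λ k → ℤ.- + k) (ℕP.m∸[m∸n]≡n n<M)))
    (⊖∈range M (M ℕ.∸ suc n) (ℕP.≤-trans (ℕP.m∸n≤m M (suc n)) (ℕP.≤-trans (ℕP.m≤m+n M M) (ℕP.≤-reflexive (sym (2*M≡M+M M))))))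

Unique-range : ∀ M → Unique (range M)
Unique-range M = Unique.map⁺ shift-injective (Unique.upTo⁺ (suc (2 ℕ.* M)))
  where
  shift-injective : ∀ {i j} → + i ℤ.- + M ≡ + j ℤ.- + M → i ≡ j
  shift-injective {i} {j} eq = ℤP.+-injective (begin
    + i                   ≡⟨ solve 2 (λ i m → i := i :- m :+ m) refl (+ i) (+ M) ⟩
    + i ℤ.- + M ℤ.+ + M    ≡⟨ cong (ℤ._+ + M) eq ⟩
    + j ℤ.- + M ℤ.+ + M    ≡⟨ solve 2 (λ j m → j :- m :+ m := j) refl (+ j) (+ M) ⟩
    + j                   ∎)
    where open ≡-Reasoning

sum-concatMap : ∀ {A : Set} (g : A → List ℕ) xs → sum (concatMap g xs) ≡ sum (map (sum ∘ g) xs)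
sum-concatMap g []       = refl
sum-concatMap g (x ∷ xs) = trans (sum-++ (g x) (concatMap g xs)) (cong (sum (g x) ℕ.+_) (sum-concatMap g xs))

boxSum≡ : ∀ B f → boxSum B f ≡
  sum (map (λ r → sum (map (λ s → sum (map (λ t → f r s t) (range B))) (range B))) (range B))
boxSum≡ B f = trans (sum-concatMap (λ r → concatMap (λ s → map (λ t → f r s t) (range B)) (range B)) (range B))
  (cong sum (List.map-cong (λ r → sum-concatMap (λ s → map (λ t → f r s t) (range B)) (range B)) (range B)))

boxSum-≤ : ∀ B K f →
  (∀ {r s t} → r ∈ range B → s ∈ range B → t ∈ range B → f r s t ℕ.≤ K) →
  (∀ {r s t} → r ∈ range B → s ∈ range B → t ∈ range B → r ≢ + 0 → s ≢ + 0 → f r s t ℕ.≤ 1) →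
  boxSum B f ℕ.≤ suc (2 ℕ.* B) ℕ.^ 3 ℕ.+ 2 ℕ.* suc (2 ℕ.* B) ℕ.^ 2 ℕ.* K
boxSum-≤ B K f ≤K ≤1 = begin
  boxSum B f                   ≡⟨ boxSum≡ B f ⟩
  sum (map Σst R)              ≤⟨ sum-≤-except Σst (n ℕ.* (n ℕ.* 1) ℕ.+ n ℕ.* K) (n ℕ.* (n ℕ.* K))
                                    (λ r∈ → ℕP.≤-trans (Σst≤ r∈) (ℕP.m≤n+m _ (n ℕ.* (n ℕ.* 1) ℕ.+ n ℕ.* K))) Σst≤-off ⟩
  n ℕ.* (n ℕ.* (n ℕ.* 1) ℕ.+ n ℕ.* K) ℕ.+ n ℕ.* (n ℕ.* K)
                               ≡⟨ ℕS.solve 2 (λ n K → n ℕS.:* (n ℕS.:* (n ℕS.:* ℕS.con 1) ℕS.:+ n ℕS.:* K) ℕS.:+ n ℕS.:* (n ℕS.:* K)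
                                    ℕS.:= n ℕS.:^ 3 ℕS.:+ ℕS.con 2 ℕS.:* n ℕS.:^ 2 ℕS.:* K) refl n K ⟩
  n ℕ.^ 3 ℕ.+ 2 ℕ.* n ℕ.^ 2 ℕ.* K ∎
  where
  open ℕP.≤-Reasoning
  R = range B
  n = suc (2 ℕ.* B)
  sum-≤ : ∀ g a → (∀ {x} → x ∈ R → g x ℕ.≤ a) → sum (map g R) ℕ.≤ n ℕ.* a
  sum-≤ g a g≤ = subst (λ ℓ → sum (map g R) ℕ.≤ ℓ ℕ.* a) (length-range B) (sum-map-≤ g a g≤)
  sum-≤-except : ∀ g a c → (∀ {x} → x ∈ R → g x ℕ.≤ a ℕ.+ c) → (∀ {x} → x ∈ R → x ≢ + 0 → g x ℕ.≤ a) →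
    sum (map g R) ℕ.≤ n ℕ.* a ℕ.+ c
  sum-≤-except g a c g≤a+c g≤a = subst (λ ℓ → sum (map g R) ℕ.≤ ℓ ℕ.* a ℕ.+ c) (length-range B)
    (sum-map-≤-except ℤ._≟_ g a c (+ 0) (Unique-range B) g≤a+c g≤a)
  Σt : ℤ → ℤ → ℕ
  Σt r s = sum (map (f r s) R)
  Σst : ℤ → ℕ
  Σst r = sum (map (Σt r) R)
  Σst≤ : ∀ {r} → r ∈ R → Σst r ℕ.≤ n ℕ.* (n ℕ.* K)
  Σst≤ r∈ = sum-≤ (Σt _) _ (λ s∈ → sum-≤ _ K (λ t∈ → ≤K r∈ s∈ t∈))
  Σst≤-off : ∀ {r} → r ∈ R → r ≢ + 0 → Σst r ℕ.≤ n ℕ.* (n ℕ.* 1) ℕ.+ n ℕ.* K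
  Σst≤-off r∈ r≢0 = sum-≤-except (Σt _) (n ℕ.* 1) (n ℕ.* K)
    (λ s∈ → ℕP.≤-trans (sum-≤ _ K (λ t∈ → ≤K r∈ s∈ t∈)) (ℕP.m≤n+m _ (n ℕ.* 1)))
    (λ s∈ s≢0 → sum-≤ _ 1 (λ t∈ → ≤1 r∈ s∈ t∈ r≢0 s≢0))

length≤1-of-constant : ∀ {zs : List ℤ} c → Unique zs → (∀ {z} → z ∈ zs → z ≡ c) → length zs ℕ.≤ 1
length≤1-of-constant c !zs ≡c = Unique-length-≤ ℤ._≟_ {ys = c ∷ []} !zs (λ z∈ → here (≡c z∈))

length≤-of-bounded : ∀ {zs : List ℤ} M → Unique zs → (∀ {z} → z ∈ zs → ℤ.∣ z ∣ ℕ.≤ M) → length zs ℕ.≤ suc (2 ℕ.* M)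
length≤-of-bounded {zs} M !zs ≤M = subst (length zs ℕ.≤_) (length-range M)
  (Unique-length-≤ ℤ._≟_ !zs (λ z∈ → Equivalence.from (∈range⇔ M _) (≤M z∈)))

pair-in-range-bound : ∀ {B s t} → s ∈ range B → t ∈ range B →
  suc (2 ℕ.* (ℤ.∣ s ∣ ℕ.+ ℤ.∣ t ∣)) ℕ.≤ 2 ℕ.* suc (2 ℕ.* B)
pair-in-range-bound {B} {s} {t} s∈ t∈ = begin
  suc (2 ℕ.* (ℤ.∣ s ∣ ℕ.+ ℤ.∣ t ∣)) ≤⟨ s≤s (ℕP.*-monoʳ-≤ 2 (ℕP.+-mono-≤ (Equivalence.to (∈range⇔ B s) s∈) (Equivalence.to (∈range⇔ B t) t∈))) ⟩
  suc (2 ℕ.* (B ℕ.+ B))            ≤⟨ ℕP.n≤1+n _ ⟩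
  suc (suc (2 ℕ.* (B ℕ.+ B)))      ≡⟨ ℕS.solve 1 (λ B → ℕS.con 2 ℕS.:+ ℕS.con 2 ℕS.:* (B ℕS.:+ B) ℕS.:= ℕS.con 2 ℕS.:* (ℕS.con 1 ℕS.:+ ℕS.con 2 ℕS.:* B)) refl B ⟩
  2 ℕ.* suc (2 ℕ.* B)              ∎
  where open ℕP.≤-Reasoning

module _ {n₁ n₂ n₃ : ℕ} (3≤n₁ : 3 ℕ.≤ n₁) (3≤n₂ : 3 ℕ.≤ n₂) (3≤n₃ : 3 ℕ.≤ n₃) (r s t : ℤ) {zs : List ℤ} (!zs : Unique zs)
         (orbit : ∀ {z} → z ∈ zs → InOrbit (φ r s t) (ι (β n₁ n₂ n₃ r s t)) (ι z)) where

  length-orbit-integers-off-axes : r ≢ + 0 → s ≢ + 0 → length zs ℕ.≤ 1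
  length-orbit-integers-off-axes r≢0 s≢0 = length≤1-of-constant (β n₁ n₂ n₃ r s t) !zs
    (λ {z} z∈ → orbit-integers-off-axes r s t 3≤n₁ 3≤n₂ 3≤n₃ r≢0 s≢0 z (orbit z∈))

  length-orbit-integers : length zs ℕ.≤ suc (2 ℕ.* (ℤ.∣ s ∣ ℕ.+ ℤ.∣ t ∣))
  length-orbit-integers with r ℤ.* s ℤ.≟ + 0
  ... | yes rs≡0 = length≤-of-bounded (ℤ.∣ s ∣ ℕ.+ ℤ.∣ t ∣) !zs (λ {z} z∈ →
    orbit-integers-on-axes {n₃ = n₃} r s t (ℕP.≤-trans (s≤s z≤n) 3≤n₁) (ℕP.≤-trans (s≤s z≤n) 3≤n₂) rs≡0 z (orbit z∈))
  ... | no rs≢0 = ℕP.≤-trans (length-orbit-integers-off-axes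
                    (λ r≡0 → rs≢0 (cong (ℤ._* s) r≡0))
                    (λ s≡0 → rs≢0 (trans (cong (r ℤ.*_) s≡0) (ℤP.*-zeroʳ r))))
                  (s≤s z≤n)

open import Data.Nat using (_*_; _^_; _≤_)

theorem3p7 : (n₁ n₂ n₃ : ℕ) → 6 ≤ n₁ → 6 ≤ n₂ → 6 ≤ n₃ →
    ∃ λ (C : ℕ) → (B : ℕ) →
    (L : ℤ → ℤ → ℤ → List ℤ) →
    (∀ r s t → Unique (L r s t)) →
    (∀ r s t z → z ∈ L r s t → InOrbit (φ r s t) (ι (β n₁ n₂ n₃ r s t)) (ι z)) →
    boxSum B (λ r s t → length (L r s t)) ≤ C * (suc (2 * B)) ^ 3
theorem3p7 n₁ n₂ n₃ 6≤n₁ 6≤n₂ 6≤n₃ = 5 , λ B L unique orbit → ℕP.≤-trans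
  (boxSum-≤ B (2 * suc (2 * B)) (λ r s t → length (L r s t))
    (λ {r} {s} {t} _ s∈ t∈ → ℕP.≤-trans
      (length-orbit-integers 3≤n₁ 3≤n₂ 3≤n₃ r s t (unique r s t) (orbit r s t _)) (pair-in-range-bound {B} s∈ t∈))
    (λ {r} {s} {t} _ _ _ → length-orbit-integers-off-axes 3≤n₁ 3≤n₂ 3≤n₃ r s t (unique r s t) (orbit r s t _)))
  (ℕP.≤-reflexive (ℕS.solve 1 (λ n → n ℕS.:^ 3 ℕS.:+ ℕS.con 2 ℕS.:* n ℕS.:^ 2 ℕS.:* (ℕS.con 2 ℕS.:* n)
    ℕS.:= ℕS.con 5 ℕS.:* n ℕS.:^ 3) refl (suc (2 * B))))
  where
  3≤n₁ : 3 ≤ n₁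
  3≤n₁ = ℕP.≤-trans (ℕP.m≤m+n 3 3) 6≤n₁
  3≤n₂ : 3 ≤ n₂
  3≤n₂ = ℕP.≤-trans (ℕP.m≤m+n 3 3) 6≤n₂
  3≤n₃ : 3 ≤ n₃
  3≤n₃ = ℕP.≤-trans (ℕP.m≤m+n 3 3) 6≤n₃
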